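{- Let $p$ be a prime, $d \geq 0$ an integer, and $G = (\mathbb{Z}/p\mathbb{Z})^d$. Let $t$ and $r$ be integers with $0 \leq t \leq d$, $p^t < r \leq p^{t+1}$ and $r \leq p^d$. Then \[\rho_G^-(r) \leq p^t \min\left\{2\left\lceil\frac{r}{p^t}\right\rceil - 1,\ p\right\}.\]
   Context: For subsets $A,B$ of an abelian group $G$, $A - B = \{a - b \mid a \in A, b \in B\}$. For a finite abelian group $G$ of order $N$ and $1 \leq r \leq N$, $\rho_G^-(r) = \min\{|A - A| \mid A \subseteq G, |A| = r\}$. -}

module Defs where

open import Data.Nat using (ℕ; _+_; _*_; _∸_; _^_; _≤_; _<_; _⊓_; NonZero)
open import Data.Nat.Properties using (m^n≢0)
open import Data.Nat.DivMod using (_/_; _mod_)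
open import Data.Nat.Primality using (Prime; prime⇒nonZero)
open import Data.Fin using (Fin; toℕ)
open import Data.Vec using (Vec; zipWith)
open import Data.List using (List; length)
open import Data.List.Membership.Propositional using (_∈_)
open import Data.List.Relation.Unary.Unique.Propositional using (Unique)
open import Data.Product using (Σ; ∃; _×_)
open import Relation.Binary.PropositionalEquality using (_≡_)
open import Function.Bundles using (_⇔_)

G : ℕ → ℕ → Set
G p d = Vec (Fin p) d

subFin : (p : ℕ) → .{{NonZero p}} → Fin p → Fin p → Fin p
subFin p a b = (toℕ a + (p ∸ toℕ b)) mod p

subG : (p : ℕ) → Prime p → {d : ℕ} → G p d → G p d → G p d
subG p pp x y = zipWith (subFin p {{prime⇒nonZero pp}}) x y

-- A finite subset of G is represented as a duplicate-free list;
-- its cardinality is the length of that list.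
-- D is (a duplicate-free enumeration of) the difference set A - A.
IsDiffSet : (p : ℕ) → Prime p → (d : ℕ) → List (G p d) → List (G p d) → Set
IsDiffSet p pp d A D =
  Unique D × (∀ x → (x ∈ D) ⇔ (Σ (G p d) λ a → Σ (G p d) λ b →
                                 a ∈ A × b ∈ A × x ≡ subG p pp a b))

ceilDivPow : (p : ℕ) → Prime p → (r t : ℕ) → ℕ
ceilDivPow p pp r t = (r + (p ^ t ∸ 1)) / (p ^ t)
  where instance
    _ = prime⇒nonZero pp
    _ = m^n≢0 p t {{prime⇒nonZero pp}}

bound : (p : ℕ) → Prime p → (r t : ℕ) → ℕ
bound p pp r t = p ^ t * ((2 * ceilDivPow p pp r t ∸ 1) ⊓ p)

-- "ρ_G^-(r) ≤ m": some A ⊆ G with |A| = r has |A - A| ≤ m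
-- (ρ is the minimum of |A - A| over such A, so this is the unfolding of min ≤ m).
RhoMinusLe : (p : ℕ) → Prime p → (d r m : ℕ) → Set
RhoMinusLe p pp d r m =
  Σ (List (G p d)) λ A → Unique A × length A ≡ r ×
    Σ (List (G p d)) λ D → IsDiffSet p pp d A D × length D ≤ m

-- Write q = p^t and k = ⌈r/q⌉, so r ≤ k·q and k ≤ p; also t < d, so
-- d = (t + 1) + e.  Let I = {0, …, k-1} ⊆ ℤ/pℤ and consider the box
--   B = I × (ℤ/pℤ)^t × {0}^e ⊆ G,      |B| = k·q ≥ r.
-- Any r elements A of B satisfy A - A ⊆ B - B ⊆ (I - I) × (ℤ/pℤ)^t × {0}^e,
-- and I - I consists of the 2k-1 residues -(k-1), …, k-1, hence has at
-- most min{2k-1, p} elements.  So |A - A| ≤ q · min{2k-1, p}.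
module Submission where

open import Defs
open import Data.Nat using (ℕ; zero; suc; _+_; _*_; _∸_; _^_; _⊓_; _≤_; _<_; NonZero; s≤s; _≤?_; >-nonZero⁻¹)
open import Data.Nat.Properties
  using (≤-refl; ≤-pred; ≤-trans; ≤-reflexive; ∸-monoʳ-<; +-cancelʳ-≤; +-monoˡ-≤; +-comm; <⇒≤pred; +-mono-≤-<; ≰⇒>; <⇒≱; ^-monoʳ-≤; m∸n+n≡m; +-∸-assoc; +-assoc; +-mono-≤; m∸n≤m; +-monoʳ-<; +-identityʳ; m≥n⇒m⊓n≡n; <⇒≤; m≤n⇒m⊓n≡m; *-comm; m≤n⇒∃[o]m+o≡n; <-≤-trans; m^n≢0; module ≤-Reasoning)
open import Data.Nat.DivMod using (_/_; _%_; _mod_; m≡m%n+[m/n]*n; m%n<n; m<n*o⇒m/o<n; n%n≡0; m<n⇒m%n≡m)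
open import Data.Nat.Primality using (Prime; prime⇒nonZero)
open import Data.Fin using (Fin; toℕ; fromℕ<; inject≤; _≟_)
open import Data.Fin.Properties using (toℕ-injective; toℕ-inject≤; inject≤-injective; toℕ-fromℕ<; toℕ<n)
open import Data.Vec using (Vec; []; _∷_; _++_; replicate; zipWith)
open import Data.Vec.Properties using (∷-injective; ++-injectiveˡ; zipWith-++; zipWith-replicate; ≡-dec)
open import Data.List as L using (List; length; take; filter; deduplicate; tabulate; allFin; cartesianProductWith)
open import Data.List.Properties using (length-++; length-map; length-tabulate; length-take; length-filter; length-deduplicate)
open import Data.List.Membership.Propositional using (_∈_)
open import Data.List.Membership.Propositional.Properties using (∈-allFin; ∈-tabulate⁺; ∈-tabulate⁻; ∈-filter⁺; ∈-filter⁻; ∈-deduplicate⁺; ∈-cartesianProductWith⁺; ∈-cartesianProductWith⁻)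
open import Data.List.Relation.Unary.Any using (here)
open import Data.List.Relation.Unary.Unique.Propositional using (Unique)
open import Data.List.Relation.Unary.Unique.Propositional.Properties using (cartesianProductWith⁺; allFin⁺; tabulate⁺; filter⁺; take⁺)
open import Data.List.Relation.Unary.Unique.DecPropositional.Properties using (deduplicate-!)
open import Data.List.Relation.Binary.Sublist.Propositional using (lookup)
open import Data.List.Relation.Binary.Sublist.Propositional.Properties using (take-⊆)
import Data.List.Membership.DecPropositional as DecMembership
import Data.List.Relation.Unary.AllPairs as AllPairs
import Data.List.Relation.Unary.All as All
open import Data.Product using (Σ; _×_; _,_; proj₁; proj₂)
open import Relation.Binary.Definitions using (DecidableEquality)
open import Relation.Binary.PropositionalEquality
open import Function.Bundles using (_⇔_; mk⇔)
open import Relation.Nullary using (Dec; yes; no)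

length-cartesianProductWith : ∀ {A B C : Set} (f : A → B → C) (xs : List A) (ys : List B) →
  length (cartesianProductWith f xs ys) ≡ length xs * length ys
length-cartesianProductWith f L.[] ys = refl
length-cartesianProductWith f (x L.∷ xs) ys = begin
    length (L.map (f x) ys L.++ cartesianProductWith f xs ys)
  ≡⟨ length-++ (L.map (f x) ys) ⟩
    length (L.map (f x) ys) + length (cartesianProductWith f xs ys)
  ≡⟨ cong₂ _+_ (length-map (f x) ys) (length-cartesianProductWith f xs ys) ⟩
    length ys + length xs * length ys ∎
  where open ≡-Reasoning

module Vectors {A : Set} (xs : List A) where

  vectors : ∀ n → List (Vec A n)
  vectors zero = [] L.∷ L.[]
  vectors (suc n) = cartesianProductWith _∷_ xs (vectors n)

  vectors-unique : Unique xs → ∀ n → Unique (vectors n)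
  vectors-unique xs! zero = All.[] AllPairs.∷ AllPairs.[]
  vectors-unique xs! (suc n) = cartesianProductWith⁺ _∷_ ∷-injective xs! (vectors-unique xs! n)

  vectors-complete : (∀ x → x ∈ xs) → ∀ n (v : Vec A n) → v ∈ vectors n
  vectors-complete xs-all zero [] = here refl
  vectors-complete xs-all (suc n) (x ∷ v) =
    ∈-cartesianProductWith⁺ _∷_ (xs-all x) (vectors-complete xs-all n v)

  length-vectors : ∀ n → length (vectors n) ≡ length xs ^ n
  length-vectors zero = refl
  length-vectors (suc n) = trans (length-cartesianProductWith _∷_ xs (vectors n))
                                 (cong (length xs *_) (length-vectors n))

module DifferenceSets {X : Set} (_≟ₓ_ : DecidableEquality X) (_−_ : X → X → X) where
  open DecMembership _≟ₓ_ using (_∈?_)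

  IsDifferenceSetOf : List X → List X → Set
  IsDifferenceSetOf A D =
    Unique D × (∀ x → (x ∈ D) ⇔ (Σ X λ a → Σ X λ b → a ∈ A × b ∈ A × x ≡ a − b))

  differenceSet-within : (A S : List X) (m : ℕ) → (∀ {a b} → a ∈ A → b ∈ A → a − b ∈ S) →
    length S ≤ m → Σ (List X) λ D → IsDifferenceSetOf A D × length D ≤ m
  differenceSet-within A S m covered |S|≤m =
    D , (filter⁺ isDifference? (deduplicate-! _≟ₓ_ S) , λ x → mk⇔ (sound x) complete) ,
    ≤-trans (length-filter isDifference? (deduplicate _≟ₓ_ S))
            (≤-trans (length-deduplicate _≟ₓ_ S) |S|≤m)
    where
    differences : List X
    differences = cartesianProductWith _−_ A A

    isDifference? : ∀ x → Dec (x ∈ differences)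
    isDifference? = _∈? differences

    D : List X
    D = filter isDifference? (deduplicate _≟ₓ_ S)

    sound : ∀ x → x ∈ D → Σ X λ a → Σ X λ b → a ∈ A × b ∈ A × x ≡ a − b
    sound x x∈D = ∈-cartesianProductWith⁻ _−_ A A
                    (proj₂ (∈-filter⁻ isDifference? {xs = deduplicate _≟ₓ_ S} x∈D))

    complete : ∀ {x} → (Σ X λ a → Σ X λ b → a ∈ A × b ∈ A × x ≡ a − b) → x ∈ D
    complete (a , b , a∈A , b∈A , refl) = ∈-filter⁺ isDifference?
      (∈-deduplicate⁺ _≟ₓ_ (covered a∈A b∈A))
      (∈-cartesianProductWith⁺ _−_ a∈A b∈A)

module CeilingQuotient (q : ℕ) .{{_ : NonZero q}} (r : ℕ) where

  k : ℕ
  k = (r + (q ∸ 1)) / q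

  q∸1<q : q ∸ 1 < q
  q∸1<q = ∸-monoʳ-< {o = 0} (s≤s ≤-refl) (>-nonZero⁻¹ q)

  -- r ≤ ⌈r/q⌉·q: the remainder of r + (q - 1) is at most q - 1.
  r≤k*q : r ≤ k * q
  r≤k*q = +-cancelʳ-≤ (q ∸ 1) r (k * q) (begin
      r + (q ∸ 1)                       ≡⟨ m≡m%n+[m/n]*n (r + (q ∸ 1)) q ⟩
      (r + (q ∸ 1)) % q + k * q         ≤⟨ +-monoˡ-≤ (k * q) (<⇒≤pred (m%n<n (r + (q ∸ 1)) q)) ⟩
      (q ∸ 1) + k * q                   ≡⟨ +-comm (q ∸ 1) (k * q) ⟩
      k * q + (q ∸ 1)                   ∎)
    where open ≤-Reasoning

  -- If r ≤ p·q then ⌈r/q⌉ ≤ p, since r + (q - 1) < (p + 1)·q.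
  r≤p*q⇒k≤p : ∀ p → r ≤ p * q → k ≤ p
  r≤p*q⇒k≤p p r≤p*q = ≤-pred (m<n*o⇒m/o<n (begin-strict
      r + (q ∸ 1)   <⟨ +-mono-≤-< r≤p*q q∸1<q ⟩
      p * q + q     ≡⟨ +-comm (p * q) q ⟩
      suc p * q     ∎))
    where open ≤-Reasoning

^-cancelʳ-< : ∀ m .{{_ : NonZero m}} t d → m ^ t < m ^ d → t < d
^-cancelʳ-< m t d lt = ≰⇒> (λ d≤t → <⇒≱ lt (^-monoʳ-≤ m d≤t))

module Residues (p : ℕ) .{{_ : NonZero p}} where

  _−_ : Fin p → Fin p → Fin p
  _−_ = subFin p

  0ₚ : Fin p
  0ₚ = 0 mod p

  toℕ-0ₚ : toℕ 0ₚ ≡ 0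
  toℕ-0ₚ = trans (toℕ-fromℕ< (m%n<n 0 p)) (m<n⇒m%n≡m (>-nonZero⁻¹ p))

  0ₚ−0ₚ : 0ₚ − 0ₚ ≡ 0ₚ
  0ₚ−0ₚ = toℕ-injective (begin
      toℕ ((toℕ 0ₚ + (p ∸ toℕ 0ₚ)) mod p)   ≡⟨ toℕ-fromℕ< (m%n<n _ p) ⟩
      (toℕ 0ₚ + (p ∸ toℕ 0ₚ)) % p           ≡⟨ cong (λ u → (u + (p ∸ u)) % p) toℕ-0ₚ ⟩
      p % p                                 ≡⟨ n%n≡0 p ⟩
      0                                     ≡⟨ sym toℕ-0ₚ ⟩
      toℕ 0ₚ                                ∎)
    where open ≡-Reasoning

  interval : ∀ k → k ≤ p → List (Fin p)
  interval k k≤p = tabulate {n = k} (λ i → inject≤ i k≤p)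

  interval-unique : ∀ k (k≤p : k ≤ p) → Unique (interval k k≤p)
  interval-unique k k≤p = tabulate⁺ (λ {i} {j} → inject≤-injective k≤p k≤p i j)

  interval-< : ∀ k (k≤p : k ≤ p) {j} → j ∈ interval k k≤p → toℕ j < k
  interval-< k k≤p j∈ with ∈-tabulate⁻ j∈
  ... | i , refl = subst (_< k) (sym (toℕ-inject≤ i k≤p)) (toℕ<n i)

  -- j - j' = (j + (c - j')) - c as naturals before reduction mod p,
  -- for j' ≤ c ≤ p; this writes a difference as a shifted residue.
  shift-split : ∀ j j' c → j' ≤ c → c ≤ p → j + (p ∸ j') ≡ (j + (c ∸ j')) + (p ∸ c)
  shift-split j j' c j'≤c c≤p = begin
      j + (p ∸ j')                 ≡⟨ cong (λ u → j + (u ∸ j')) (sym (m∸n+n≡m c≤p)) ⟩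
      j + ((p ∸ c) + c ∸ j')       ≡⟨ cong (j +_) (+-∸-assoc (p ∸ c) j'≤c) ⟩
      j + ((p ∸ c) + (c ∸ j'))     ≡⟨ cong (j +_) (+-comm (p ∸ c) (c ∸ j')) ⟩
      j + ((c ∸ j') + (p ∸ c))     ≡⟨ sym (+-assoc j (c ∸ j') (p ∸ c)) ⟩
      (j + (c ∸ j')) + (p ∸ c)     ∎
    where open ≡-Reasoning

  shift-< : ∀ j j' k → j < k → j + (k ∸ 1 ∸ j') < 2 * k ∸ 1
  shift-< j j' (suc k) (s≤s j≤k) = begin-strict
      j + (k ∸ j')       ≤⟨ +-mono-≤ j≤k (m∸n≤m k j') ⟩
      k + k              <⟨ +-monoʳ-< k (s≤s (≤-reflexive (sym (+-identityʳ k)))) ⟩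
      k + suc (k + 0)    ∎
    where open ≤-Reasoning

  -- I - I for the interval I = {0, …, k-1} is covered by min{2k-1, p}
  -- residues: the residues m - (k-1) with m < 2k - 1, or all of ℤ/pℤ.
  interval-differences : ∀ k → k ≤ p → Σ (List (Fin p)) λ Js →
    length Js ≡ (2 * k ∸ 1) ⊓ p × (∀ j j' → toℕ j < k → toℕ j' < k → j − j' ∈ Js)
  interval-differences k k≤p with 2 * k ∸ 1 ≤? p
  ... | no 2k-1≰p = allFin p
      , trans (length-tabulate {n = p} (λ i → i)) (sym (m≥n⇒m⊓n≡n (<⇒≤ (≰⇒> 2k-1≰p))))
      , λ j j' _ _ → ∈-allFin (j − j')
  ... | yes 2k-1≤p = tabulate unshift
      , trans (length-tabulate unshift) (sym (m≤n⇒m⊓n≡m 2k-1≤p))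
      , covered
    where
    unshift : Fin (2 * k ∸ 1) → Fin p
    unshift m = (toℕ m + (p ∸ (k ∸ 1))) mod p

    covered : ∀ j j' → toℕ j < k → toℕ j' < k → j − j' ∈ tabulate unshift
    covered j j' j<k j'<k = subst (_∈ tabulate unshift) (sym difference-is-unshift)
                                  (∈-tabulate⁺ (fromℕ< shift<))
      where
      shift< : toℕ j + (k ∸ 1 ∸ toℕ j') < 2 * k ∸ 1
      shift< = shift-< (toℕ j) (toℕ j') k j<k
      difference-is-unshift : j − j' ≡ unshift (fromℕ< shift<)
      difference-is-unshift = trans
        (cong (_mod p) (shift-split (toℕ j) (toℕ j') (k ∸ 1)
                          (<⇒≤pred j'<k)
                          (≤-trans (m∸n≤m k 1) k≤p)))
        (cong (λ u → (u + (p ∸ (k ∸ 1))) mod p) (sym (toℕ-fromℕ< shift<)))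

module Boxes (p : ℕ) (pp : Prime p) (t e k : ℕ) (k≤p : k ≤ p) where
  instance
    p≢0 : NonZero p
    p≢0 = prime⇒nonZero pp

  open Residues p
  open Vectors (allFin p)

  embed : Fin p → Vec (Fin p) t → G p (suc t + e)
  embed j x = j ∷ (x ++ replicate e 0ₚ)

  embed-injective : ∀ {j j' x x'} → embed j x ≡ embed j' x' → j ≡ j' × x ≡ x'
  embed-injective {x = x} {x'} eq with ∷-injective eq
  ... | refl , tails with ++-injectiveˡ x x' tails
  ... | refl = refl , refl

  -- embed commutes with subtraction, because 0 - 0 = 0 in the padding.
  embed-− : ∀ j j' x x' → subG p pp (embed j x) (embed j' x') ≡ embed (j − j') (subG p pp x x')
  embed-− j j' x x' = cong (j − j' ∷_) (begin
      zipWith _−_ (x ++ replicate e 0ₚ) (x' ++ replicate e 0ₚ)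
    ≡⟨ zipWith-++ _−_ x (replicate e 0ₚ) x' (replicate e 0ₚ) ⟩
      subG p pp x x' ++ zipWith _−_ (replicate e 0ₚ) (replicate e 0ₚ)
    ≡⟨ cong (subG p pp x x' ++_) (trans (zipWith-replicate _−_ 0ₚ 0ₚ) (cong (replicate e) 0ₚ−0ₚ)) ⟩
      subG p pp x x' ++ replicate e 0ₚ
    ∎)
    where open ≡-Reasoning

  length-allFin : length (allFin p) ≡ p
  length-allFin = length-tabulate {n = p} (λ i → i)

  box : List (G p (suc t + e))
  box = cartesianProductWith embed (interval k k≤p) (vectors t)

  box-unique : Unique box
  box-unique = cartesianProductWith⁺ embed embed-injective
                 (interval-unique k k≤p) (vectors-unique (allFin⁺ p) t)

  length-box : length box ≡ k * p ^ t
  length-box = begin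
      length box
    ≡⟨ length-cartesianProductWith embed (interval k k≤p) (vectors t) ⟩
      length (interval k k≤p) * length (vectors t)
    ≡⟨ cong₂ _*_ (length-tabulate {n = k} (λ i → inject≤ i k≤p))
                 (trans (length-vectors t) (cong (_^ t) length-allFin)) ⟩
      k * p ^ t
    ∎
    where open ≡-Reasoning

  Js : List (Fin p)
  Js = proj₁ (interval-differences k k≤p)

  box-differences : List (G p (suc t + e))
  box-differences = cartesianProductWith embed Js (vectors t)

  length-box-differences : length box-differences ≡ p ^ t * ((2 * k ∸ 1) ⊓ p)
  length-box-differences = begin
      length box-differences
    ≡⟨ length-cartesianProductWith embed Js (vectors t) ⟩
      length Js * length (vectors t)
    ≡⟨ cong₂ _*_ (proj₁ (proj₂ (interval-differences k k≤p)))
                 (trans (length-vectors t) (cong (_^ t) length-allFin)) ⟩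
      ((2 * k ∸ 1) ⊓ p) * p ^ t
    ≡⟨ *-comm ((2 * k ∸ 1) ⊓ p) (p ^ t) ⟩
      p ^ t * ((2 * k ∸ 1) ⊓ p)
    ∎
    where open ≡-Reasoning

  box-differences-complete : ∀ {a b} → a ∈ box → b ∈ box → subG p pp a b ∈ box-differences
  box-differences-complete a∈ b∈
    with ∈-cartesianProductWith⁻ embed (interval k k≤p) (vectors t) a∈
       | ∈-cartesianProductWith⁻ embed (interval k k≤p) (vectors t) b∈
  ... | j , x , j∈ , _ , refl | j' , x' , j'∈ , _ , refl =
    subst (_∈ box-differences) (sym (embed-− j j' x x'))
      (∈-cartesianProductWith⁺ embed
        (proj₂ (proj₂ (interval-differences k k≤p)) j j' (interval-< k k≤p j∈) (interval-< k k≤p j'∈))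
        (vectors-complete ∈-allFin t (subG p pp x x')))

  box-bound : ∀ r → r ≤ k * p ^ t → RhoMinusLe p pp (suc t + e) r (p ^ t * ((2 * k ∸ 1) ⊓ p))
  box-bound r r≤|B| =
    A , take⁺ r box-unique , |A|≡r ,
    differenceSet-within A box-differences (p ^ t * ((2 * k ∸ 1) ⊓ p))
      (λ a∈ b∈ → box-differences-complete (A⊆box a∈) (A⊆box b∈))
      (≤-reflexive length-box-differences)
    where
    open DifferenceSets (≡-dec _≟_) (subG p pp)

    A : List (G p (suc t + e))
    A = take r box

    |A|≡r : length A ≡ r
    |A|≡r = trans (length-take r box) (trans (cong (r ⊓_) length-box) (m≤n⇒m⊓n≡m r≤|B|))

    A⊆box : ∀ {a} → a ∈ A → a ∈ box
    A⊆box = lookup (take-⊆ r box)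

lemma4p1 : (p : ℕ) (pp : Prime p) (d t r : ℕ) →
           t ≤ d → p ^ t < r → r ≤ p ^ (suc t) → r ≤ p ^ d →
           RhoMinusLe p pp d r (bound p pp r t)
lemma4p1 p pp d t r _ p^t<r r≤p*p^t r≤p^d
  with m≤n⇒∃[o]m+o≡n (^-cancelʳ-< p {{prime⇒nonZero pp}} t d (<-≤-trans p^t<r r≤p^d))
... | e , refl = Boxes.box-bound p pp t e k (r≤p*q⇒k≤p p r≤p*p^t) r r≤k*q
  where
  instance
    p^t≢0 : NonZero (p ^ t)
    p^t≢0 = m^n≢0 p t {{prime⇒nonZero pp}}
  open CeilingQuotient (p ^ t) r
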